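{- Let $M=(S,S_0,\Delta)$ be the counter system of disjunctive process templates $A,B$, and let $\lessapprox$ be the order on $S$ with $(q_A,\vec c)\lessapprox(q'_A,\vec d)$ iff $q_A=q'_A$ and $\vec c\le\vec d$ componentwise. Then $(M,\lessapprox)$ has effective $\mathit{pred}$-basis: there exists an algorithm that takes as input any finite set $R\subseteq S$ and returns a finite basis of ${\uparrow}\mathit{pred}({\uparrow}R)$.
   Context: Let $Q_A,Q_B$ be disjoint finite sets and $Q=Q_A\cup Q_B$. A (disjunctive) process template is $U=(Q_U,\mathit{init}_U,\mathcal G_U,\delta_U)$ for $U\in\{A,B\}$, with $\mathit{init}_U\in Q_U$, guards $\mathcal G_U\subseteq\mathcal P(Q)$, and total transition relation $\delta_U\subseteq Q_U\times\mathcal G_U\times Q_U$. Write $Q_B=\{q_0,\dots,q_{|B|-1}\}$ and $\vec u_i$ for the $i$-th unit vector. The counter system $M=(S,S_0,\Delta)$ has $S=Q_A\times\mathbb N_0^{|B|}$, $S_0=\{(\mathit{init}_A,\vec c)\mid \vec c(q)=0\text{ for } q\neq\mathit{init}_B\}$, and $((q_A,\vec c),(q'_A,\vec c'))\in\Delta$ iff either (1) $\vec c'=\vec c$ and some $(q_A,g,q'_A)\in\delta_A$ has some $q_i\in g\cap Q_B$ with $\vec c(i)\ge1$; or (2) $q'_A=q_A$ and some $(q_i,g,q_j)\in\delta_B$ has $\vec c(i)\ge1$, $\vec c'=\vec c-\vec u_i+\vec u_j$, and ($q_A\in g$, or some $q_l\in g\cap Q_B$, $l\ne i$, has $\vec c(l)\ge1$,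 or $q_i\in g$ and $\vec c(i)\ge2$). For $R\subseteq S$, $\mathit{pred}(R)=\{s\in S\mid\exists r\in R:(s,r)\in\Delta\}$. The upward closure is ${\uparrow}R=\{s\mid\exists s'\in R: s'\lessapprox s\}$; a set $X$ is upward-closed if ${\uparrow}X=X$, and $B\subseteq S$ is a basis of upward-closed $X$ if ${\uparrow}B=X$. -}

module Defs where

open import Data.Nat using (ℕ; suc; _≤_; _≥_)
import Data.Nat as ℕ
open import Data.Fin using (Fin)
open import Data.Fin.Subset using (Subset) renaming (_∈_ to _∈ₛ_)
open import Data.Vec using (Vec; lookup; updateAt)
open import Data.List using (List)
open import Data.List.Relation.Unary.Any using (Any)
open import Data.List.Membership.Propositional using (_∈_)
open import Data.Product using (Σ; _×_; _,_; ∃; proj₁; proj₂)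
open import Data.Sum using (_⊎_)
open import Relation.Binary.PropositionalEquality using (_≡_; _≢_)

-- Q_A = Fin nA, Q_B = Fin nB (disjoint by construction: Q = Q_A ⊎ Q_B).
-- A guard g ⊆ Q = Q_A ⊎ Q_B is given by its A-part and its B-part.
Guard : ℕ → ℕ → Set
Guard nA nB = Subset nA × Subset nB

-- A process template over local states Fin n (n = nA for A, n = nB for B).
-- The guard set G_U is implicit: it is the set of guards occurring in δ.
record Template (n nA nB : ℕ) : Set where
  field
    init  : Fin n
    δ     : List (Fin n × Guard nA nB × Fin n)
    total : ∀ (q : Fin n) → Any (λ t → proj₁ t ≡ q) δ
open Template public

State : ℕ → ℕ → Set
State nA nB = Fin nA × Vec ℕ nB

module CounterSystem {nA nB : ℕ} (A : Template nA nA nB) (B : Template nB nA nB) where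

  S : Set
  S = State nA nB

  -- c - u_i + u_j  (assuming c(i) ≥ 1)
  move : Vec ℕ nB → Fin nB → Fin nB → Vec ℕ nB
  move c i j = updateAt (updateAt c i ℕ.pred) j suc

  data Δ : S → S → Set where
    stepA : ∀ {qA qA' c} {g : Guard nA nB} →
            (qA , g , qA') ∈ δ A →
            (∃ λ (i : Fin nB) → (i ∈ₛ proj₂ g) × lookup c i ≥ 1) →
            Δ (qA , c) (qA' , c)
    stepB : ∀ {qA c i j} {g : Guard nA nB} →
            (i , g , j) ∈ δ B →
            lookup c i ≥ 1 →
            ( (qA ∈ₛ proj₁ g)
            ⊎ (∃ λ (l : Fin nB) → (l ∈ₛ proj₂ g) × l ≢ i × lookup c l ≥ 1)
            ⊎ ((i ∈ₛ proj₂ g) × lookup c i ≥ 2) ) →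
            Δ (qA , c) (qA , move c i j)

  _≲_ : S → S → Set
  (qA , c) ≲ (qA' , d) = qA ≡ qA' × (∀ k → lookup c k ≤ lookup d k)

  pred : (S → Set) → S → Set
  pred X s = ∃ λ r → X r × Δ s r

  ↑ : (S → Set) → S → Set
  ↑ X s = ∃ λ s' → X s' × s' ≲ s

  ⟦_⟧ : List S → S → Set
  ⟦ L ⟧ s = s ∈ L

  IsBasis : List S → (S → Set) → Set
  IsBasis Bs X = ∀ s → (↑ ⟦ Bs ⟧ s → X s) × (X s → ↑ ⟦ Bs ⟧ s)

-- A transition only inspects and changes finitely many counters, so the
-- predecessors of an upward-closed set are again upward-closed, with a basis
-- computable from a basis of the set. For an A-step the counters stay fixed
-- and only a guard condition "some c(l) ≥ 1" is added. For a B-step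
-- c ↦ c - u_i + u_j, the vectors c with c(i) ≥ 1 and c - u_i + u_j ≥ d are
-- exactly those above d + u_i - u_j (truncated at j), because pred ⊣ suc on ℕ
-- and suc ⊣ pred on positive numbers. The guard conditions are themselves
-- upward-closed with explicit finite bases, and ↑{u} ∩ ↑{v} = ↑{u ⊔ v}.
module Submission where

open import Defs
open import Data.Nat using (ℕ; suc; _≤_; _⊔_; z≤n; s≤s; >-nonZero)
import Data.Nat as ℕ
open import Data.Nat.Properties
  using (≤-trans; m≤m⊔n; m≤n⊔m; ⊔-lub; pred-mono-≤; suc[m]≤n⇒m≤pred[n]; m≤pred[n]⇒suc[m]≤n)
open import Data.Fin using (Fin)
open import Data.Fin.Properties using (_≟_)
open import Data.Fin.Subset using (Subset) renaming (_∈_ to _∈ₛ_)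
open import Data.Fin.Subset.Properties using (_∈?_)
open import Data.Vec using (Vec; lookup; replicate; zipWith; updateAt)
open import Data.Vec.Properties using (lookup∘updateAt; lookup∘updateAt′; lookup-zipWith; lookup-replicate)
open import Data.List using (List; []; [_]; _++_; map; concatMap; allFin)
open import Data.List.Relation.Unary.Any using (here)
open import Data.List.Membership.Propositional using (_∈_; find; lose)
open import Data.List.Membership.Propositional.Properties
  using (∈-++⁺ˡ; ∈-++⁺ʳ; ∈-++⁻; ∈-map⁺; ∈-map⁻; ∈-concatMap⁺; ∈-concatMap⁻; ∈-allFin)
open import Data.Product using (Σ; ∃; _×_; _,_; proj₁; proj₂)
open import Data.Sum using (_⊎_; inj₁; inj₂)
open import Function.Bundles using (_⇔_; mk⇔; Equivalence)
open import Relation.Nullary using (Dec; yes; no; ¬?; contradiction)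
open import Relation.Binary.PropositionalEquality using (_≡_; _≢_; refl; sym; subst; subst₂)

open Equivalence using (to; from)

pred≤⇒≤suc : ∀ {m n} → ℕ.pred m ≤ n → m ≤ suc n
pred≤⇒≤suc {ℕ.zero}  _   = z≤n
pred≤⇒≤suc {suc _}   m≤n = s≤s m≤n

when : ∀ {a p} {A : Set a} {P : Set p} → Dec P → List A → List A
when (yes _) xs = xs
when (no _)  _  = []

∈-when : ∀ {a p} {A : Set a} {P : Set p} (d : Dec P) {x : A} {xs} → P → x ∈ xs → x ∈ when d xs
∈-when (yes _) _ x∈ = x∈
∈-when (no ¬p) p _  = contradiction p ¬p

module _ {n : ℕ} where

  infix  4 _≤ᵛ_
  infixl 6 _⊔ᵛ_

  _≤ᵛ_ : Vec ℕ n → Vec ℕ n → Set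
  u ≤ᵛ v = ∀ k → lookup u k ≤ lookup v k

  ≤ᵛ-trans : ∀ {u v w} → u ≤ᵛ v → v ≤ᵛ w → u ≤ᵛ w
  ≤ᵛ-trans u≤v v≤w k = ≤-trans (u≤v k) (v≤w k)

  _⊔ᵛ_ : Vec ℕ n → Vec ℕ n → Vec ℕ n
  _⊔ᵛ_ = zipWith _⊔_

  u≤ᵛu⊔ᵛv : ∀ u v → u ≤ᵛ u ⊔ᵛ v
  u≤ᵛu⊔ᵛv u v k rewrite lookup-zipWith _⊔_ k u v = m≤m⊔n _ _

  v≤ᵛu⊔ᵛv : ∀ u v → v ≤ᵛ u ⊔ᵛ v
  v≤ᵛu⊔ᵛv u v k rewrite lookup-zipWith _⊔_ k u v = m≤n⊔m _ _

  ⊔ᵛ-lub : ∀ {u v w} → u ≤ᵛ w → v ≤ᵛ w → u ⊔ᵛ v ≤ᵛ w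
  ⊔ᵛ-lub {u} {v} u≤w v≤w k rewrite lookup-zipWith _⊔_ k u v = ⊔-lub (u≤w k) (v≤w k)

  0ᵛ : Vec ℕ n
  0ᵛ = replicate n 0

  0ᵛ≤ᵛ : ∀ v → 0ᵛ ≤ᵛ v
  0ᵛ≤ᵛ v k rewrite lookup-replicate k 0 = z≤n

  atLeast : Fin n → ℕ → Vec ℕ n
  atLeast l x = updateAt 0ᵛ l (λ _ → x)

  atLeast-≤ᵛ⁻ : ∀ {l x c} → atLeast l x ≤ᵛ c → x ≤ lookup c l
  atLeast-≤ᵛ⁻ {l} x≤c = subst (_≤ _) (lookup∘updateAt l 0ᵛ) (x≤c l)

  atLeast-≤ᵛ⁺ : ∀ {l x c} → x ≤ lookup c l → atLeast l x ≤ᵛ c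
  atLeast-≤ᵛ⁺ {l} {c = c} x≤c k with k ≟ l
  ... | yes refl = subst (_≤ _) (sym (lookup∘updateAt k 0ᵛ)) x≤c
  ... | no k≢l   = subst (_≤ _) (sym (lookup∘updateAt′ k l k≢l 0ᵛ)) (0ᵛ≤ᵛ c k)

  ≤ᵛ-updateAt⇒updateAt-≤ᵛ : ∀ u v k {f g : ℕ → ℕ} →
    (lookup u k ≤ g (lookup v k) → f (lookup u k) ≤ lookup v k) →
    u ≤ᵛ updateAt v k g → updateAt u k f ≤ᵛ v
  ≤ᵛ-updateAt⇒updateAt-≤ᵛ u v k adj u≤v k′ with k′ ≟ k
  ... | yes refl = subst (_≤ _) (sym (lookup∘updateAt k u)) (adj (subst (_ ≤_) (lookup∘updateAt k v) (u≤v k)))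
  ... | no k′≢k  = subst₂ _≤_ (sym (lookup∘updateAt′ k′ k k′≢k u)) (lookup∘updateAt′ k′ k k′≢k v) (u≤v k′)

  updateAt-≤ᵛ⇒≤ᵛ-updateAt : ∀ u v k {f g : ℕ → ℕ} →
    (f (lookup u k) ≤ lookup v k → lookup u k ≤ g (lookup v k)) →
    updateAt u k f ≤ᵛ v → u ≤ᵛ updateAt v k g
  updateAt-≤ᵛ⇒≤ᵛ-updateAt u v k adj u≤v k′ with k′ ≟ k
  ... | yes refl = subst (_ ≤_) (sym (lookup∘updateAt k v)) (adj (subst (_≤ _) (lookup∘updateAt k u) (u≤v k)))
  ... | no k′≢k  = subst₂ _≤_ (lookup∘updateAt′ k′ k k′≢k u) (sym (lookup∘updateAt′ k′ k k′≢k v)) (u≤v k′)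

  -- The least c with c(i) ≥ 1 and c - u_i + u_j ≥ d; move c i j appears
  -- unfolded in the lemmas below.
  unmove : Vec ℕ n → Fin n → Fin n → Vec ℕ n
  unmove d i j = updateAt (updateAt d j ℕ.pred) i suc

  unmove-≤ᵛ⇒nonZero : ∀ {d i j c} → unmove d i j ≤ᵛ c → 1 ≤ lookup c i
  unmove-≤ᵛ⇒nonZero {d} {i} {j} u≤c =
    ≤-trans (s≤s z≤n) (subst (_≤ _) (lookup∘updateAt i (updateAt d j ℕ.pred)) (u≤c i))

  unmove-≤ᵛ⇒≤ᵛ-move : ∀ {d i j c} → unmove d i j ≤ᵛ c → d ≤ᵛ updateAt (updateAt c i ℕ.pred) j suc
  unmove-≤ᵛ⇒≤ᵛ-move {d = d} {i} {j} {c} u≤c =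
    updateAt-≤ᵛ⇒≤ᵛ-updateAt d (updateAt c i ℕ.pred) j {ℕ.pred} {suc} pred≤⇒≤suc
      (updateAt-≤ᵛ⇒≤ᵛ-updateAt (updateAt d j ℕ.pred) c i {suc} {ℕ.pred} suc[m]≤n⇒m≤pred[n] u≤c)

  ≤ᵛ-move⇒unmove-≤ᵛ : ∀ {d i j c} → 1 ≤ lookup c i →
    d ≤ᵛ updateAt (updateAt c i ℕ.pred) j suc → unmove d i j ≤ᵛ c
  ≤ᵛ-move⇒unmove-≤ᵛ {d = d} {i} {j} {c} ci≥1 d≤c′ =
    ≤ᵛ-updateAt⇒updateAt-≤ᵛ (updateAt d j ℕ.pred) c i {suc} {ℕ.pred}
      (m≤pred[n]⇒suc[m]≤n {{>-nonZero ci≥1}})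
      (≤ᵛ-updateAt⇒updateAt-≤ᵛ d (updateAt c i ℕ.pred) j {ℕ.pred} {suc} pred-mono-≤ d≤c′)

  ↑ᵛ : List (Vec ℕ n) → Vec ℕ n → Set
  ↑ᵛ W c = ∃ λ w → w ∈ W × w ≤ᵛ c

  _Generates_ : List (Vec ℕ n) → (Vec ℕ n → Set) → Set
  W Generates P = ∀ c → P c ⇔ ↑ᵛ W c

  atLeast-generates : ∀ l x → [ atLeast l x ] Generates (λ c → x ≤ lookup c l)
  atLeast-generates l x c = mk⇔ (λ x≤c → _ , here refl , atLeast-≤ᵛ⁺ {l} {x} {c} x≤c)
                                (λ { (_ , here refl , w≤c) → atLeast-≤ᵛ⁻ {l} {x} {c} w≤c })

  when-generates-const : ∀ {P : Set} (d : Dec P) → when d [ 0ᵛ ] Generates (λ _ → P)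
  when-generates-const (yes p) c = mk⇔ (λ _ → 0ᵛ , here refl , 0ᵛ≤ᵛ c) (λ _ → p)
  when-generates-const (no ¬p) c = mk⇔ (λ p → contradiction p ¬p) (λ { (_ , () , _) })

  when-generates : ∀ {P : Set} {Q W} (d : Dec P) → W Generates Q → when d W Generates (λ c → P × Q c)
  when-generates (yes p) W⇔Q c = mk⇔ (λ (_ , q) → to (W⇔Q c) q) (λ w → p , from (W⇔Q c) w)
  when-generates (no ¬p) W⇔Q c = mk⇔ (λ (p , _) → contradiction p ¬p) (λ { (_ , () , _) })

  ++-generates : ∀ {P Q W V} → W Generates P → V Generates Q → (W ++ V) Generates (λ c → P c ⊎ Q c)
  ++-generates {W = W} W⇔P V⇔Q c = mk⇔ into outof
    where
    into : _ → ↑ᵛ (W ++ _) c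
    into (inj₁ p) = let w , w∈ , w≤c = to (W⇔P c) p in w , ∈-++⁺ˡ w∈ , w≤c
    into (inj₂ q) = let w , w∈ , w≤c = to (V⇔Q c) q in w , ∈-++⁺ʳ W w∈ , w≤c
    outof : ↑ᵛ (W ++ _) c → _
    outof (w , w∈ , w≤c) with ∈-++⁻ W w∈
    ... | inj₁ w∈W = inj₁ (from (W⇔P c) (w , w∈W , w≤c))
    ... | inj₂ w∈V = inj₂ (from (V⇔Q c) (w , w∈V , w≤c))

  concatMap-generates : ∀ {m} {P : Fin m → Vec ℕ n → Set} {W : Fin m → List (Vec ℕ n)} →
    (∀ l → W l Generates P l) → concatMap W (allFin m) Generates (λ c → ∃ λ l → P l c)
  concatMap-generates {m} {W = W} W⇔P c = mk⇔ into outof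
    where
    into : _ → ↑ᵛ _ c
    into (l , p) = let w , w∈ , w≤c = to (W⇔P l c) p in w , ∈-concatMap⁺ W (lose (∈-allFin l) w∈) , w≤c
    outof : ↑ᵛ _ c → _
    outof (w , w∈ , w≤c) =
      let l , _ , w∈l = find (∈-concatMap⁻ W {allFin m} w∈) in l , from (W⇔P l c) (w , w∈l , w≤c)

  occupied : Subset n → List (Vec ℕ n)
  occupied G = concatMap (λ l → when (l ∈? G) [ atLeast l 1 ]) (allFin n)

  occupied-generates : ∀ G → occupied G Generates (λ c → ∃ λ l → l ∈ₛ G × 1 ≤ lookup c l)
  occupied-generates G = concatMap-generates λ l → when-generates (l ∈? G) (atLeast-generates l 1)

module _ {nA nB : ℕ} where

  enablingB : Fin nA → Guard nA nB → Fin nB → List (Vec ℕ nB)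
  enablingB qA (gA , gB) i =
    when (qA ∈? gA) [ 0ᵛ ]
    ++ concatMap (λ l → when (l ∈? gB) (when (¬? (l ≟ i)) [ atLeast l 1 ])) (allFin nB)
    ++ when (i ∈? gB) [ atLeast i 2 ]

  enablingB-generates : ∀ qA g i → enablingB qA g i Generates λ c →
      (qA ∈ₛ proj₁ g)
    ⊎ (∃ λ l → (l ∈ₛ proj₂ g) × l ≢ i × 1 ≤ lookup c l)
    ⊎ ((i ∈ₛ proj₂ g) × 2 ≤ lookup c i)
  enablingB-generates qA (gA , gB) i =
    ++-generates (when-generates-const (qA ∈? gA))
      (++-generates
        (concatMap-generates λ l → when-generates (l ∈? gB) (when-generates (¬? (l ≟ i)) (atLeast-generates l 1)))
        (when-generates (i ∈? gB) (atLeast-generates i 2)))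

module PredBasis {nA nB : ℕ} (A : Template nA nA nB) (B : Template nB nA nB) where
  open CounterSystem A B

  ≲-trans : ∀ {x y z} → x ≲ y → y ≲ z → x ≲ z
  ≲-trans {_ , c} {_ , d} {_ , e} (refl , c≤d) (refl , d≤e) = refl , ≤ᵛ-trans {u = c} {d} {e} c≤d d≤e

  predBasisA : S → Fin nA × Guard nA nB × Fin nA → List S
  predBasisA (q , d) (qA , g , qA′) = when (qA′ ≟ q) (map (λ w → qA , d ⊔ᵛ w) (occupied (proj₂ g)))

  predBasisB : S → Fin nB × Guard nA nB × Fin nB → List S
  predBasisB (q , d) (i , g , j) = map (λ w → q , unmove d i j ⊔ᵛ w) (enablingB q g i)

  predBasis : S → List S
  predBasis r = concatMap (predBasisA r) (δ A) ++ concatMap (predBasisB r) (δ B)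

  predBasisA-sound : ∀ {r t x} → t ∈ δ A → x ∈ predBasisA r t → ∃ λ r′ → r ≲ r′ × Δ x r′
  predBasisA-sound {q , d} {qA , g , qA′} t∈ x∈ with qA′ ≟ q
  ... | yes refl with ∈-map⁻ (λ w → qA , d ⊔ᵛ w) x∈
  ...   | w , w∈ , refl = (qA′ , d ⊔ᵛ w) , (refl , u≤ᵛu⊔ᵛv d w) ,
          stepA t∈ (from (occupied-generates (proj₂ g) (d ⊔ᵛ w)) (w , w∈ , v≤ᵛu⊔ᵛv d w))

  predBasisB-sound : ∀ {r t x} → t ∈ δ B → x ∈ predBasisB r t → ∃ λ r′ → r ≲ r′ × Δ x r′
  predBasisB-sound {q , d} {i , g , j} t∈ x∈ with ∈-map⁻ (λ w → q , unmove d i j ⊔ᵛ w) x∈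
  ... | w , w∈ , refl = (q , move c i j) , (refl , unmove-≤ᵛ⇒≤ᵛ-move {d = d} {i} {j} {c} unmove≤c) ,
          stepB t∈ (unmove-≤ᵛ⇒nonZero {d = d} {i} {j} {c} unmove≤c)
            (from (enablingB-generates q g i c) (w , w∈ , v≤ᵛu⊔ᵛv (unmove d i j) w))
    where
    c = unmove d i j ⊔ᵛ w
    unmove≤c = u≤ᵛu⊔ᵛv (unmove d i j) w

  predBasis-sound : ∀ {r x} → x ∈ predBasis r → ∃ λ r′ → r ≲ r′ × Δ x r′
  predBasis-sound {r} x∈ with ∈-++⁻ (concatMap (predBasisA r) (δ A)) x∈
  ... | inj₁ x∈A = let _ , t∈ , x∈t = find (∈-concatMap⁻ (predBasisA r) {δ A} x∈A) in predBasisA-sound t∈ x∈t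
  ... | inj₂ x∈B = let _ , t∈ , x∈t = find (∈-concatMap⁻ (predBasisB r) {δ B} x∈B) in predBasisB-sound t∈ x∈t

  predBasis-complete : ∀ {r r′ s} → r ≲ r′ → Δ s r′ → ∃ λ x → x ∈ predBasis r × x ≲ s
  predBasis-complete {q , d} (refl , d≤c) (stepA {qA} {c = c} {g} t∈ enabled)
    with to (occupied-generates (proj₂ g) c) enabled
  ... | w , w∈ , w≤c =
    (qA , d ⊔ᵛ w) ,
    ∈-++⁺ˡ (∈-concatMap⁺ (predBasisA (q , d))
      (lose t∈ (∈-when (q ≟ q) refl (∈-map⁺ (λ w → qA , d ⊔ᵛ w) w∈)))) ,
    refl , ⊔ᵛ-lub {u = d} {w} {c} d≤c w≤c
  predBasis-complete {q , d} (refl , d≤c′) (stepB {c = c} {i} {j} {g} t∈ ci≥1 enabled)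
    with to (enablingB-generates q g i c) enabled
  ... | w , w∈ , w≤c =
    (q , unmove d i j ⊔ᵛ w) ,
    ∈-++⁺ʳ (concatMap (predBasisA (q , d)) (δ A))
      (∈-concatMap⁺ (predBasisB (q , d)) (lose t∈ (∈-map⁺ (λ w → q , unmove d i j ⊔ᵛ w) w∈))) ,
    refl , ⊔ᵛ-lub {u = unmove d i j} {w} {c} (≤ᵛ-move⇒unmove-≤ᵛ {d = d} {i} {j} {c} ci≥1 d≤c′) w≤c

  algorithm : List S → List S
  algorithm = concatMap predBasis

  algorithm-isBasis : ∀ R → IsBasis (algorithm R) (↑ (pred (↑ ⟦ R ⟧)))
  algorithm-isBasis R s = sound , complete
    where
    sound : ↑ ⟦ algorithm R ⟧ s → ↑ (pred (↑ ⟦ R ⟧)) s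
    sound (x , x∈ , x≲s) with find (∈-concatMap⁻ predBasis {R} x∈)
    ... | r , r∈ , x∈r with predBasis-sound x∈r
    ...   | r′ , r≲r′ , step = x , (r′ , (r , r∈ , r≲r′) , step) , x≲s

    complete : ↑ (pred (↑ ⟦ R ⟧)) s → ↑ ⟦ algorithm R ⟧ s
    complete (s′ , (r′ , (r , r∈ , r≲r′) , step) , s′≲s) with predBasis-complete r≲r′ step
    ... | x , x∈ , x≲s′ = x , ∈-concatMap⁺ predBasis (lose r∈ x∈) , ≲-trans {x} {s′} {s} x≲s′ s′≲s

lemma2 : ∀ {nA nB : ℕ} (A : Template nA nA nB) (B : Template nB nA nB) →
    let open CounterSystem A B in
    Σ (List S → List S) (λ alg →
    ∀ (R : List S) → IsBasis (alg R) (↑ (pred (↑ ⟦ R ⟧))))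
lemma2 A B = PredBasis.algorithm A B , PredBasis.algorithm-isBasis A B
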